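{- Let $G$ be a finite connected graph of order $n\geq 3$ with $s$ support vertices and $\ell$ pendant vertices, and let $\delta^{*}(G)$ denote the minimum degree taken over all vertices of $G$ which are not pendant vertices. Then $$L_{2}(G)\leq \frac{2\bigl(n-\ell+s\,\delta^{*}(G)\bigr)}{1+\delta^{*}(G)},$$ and this bound is sharp, i.e., equality holds for some such graph $G$.
   Context: All graphs are finite and simple. For a vertex $v$, $N[v]$ is its closed neighbourhood. For an integer $k\geq 1$, a set $B\subseteq V(G)$ is a $k$-limited packing set if $|N[v]\cap B|\leq k$ for every $v\in V(G)$; the $k$-limited packing number $L_k(G)$ is the maximum cardinality of a $k$-limited packing set. A pendant vertex is a vertex of degree $1$; a support vertex is a vertex adjacent to at least one pendant vertex. -}

module Defs where

open import Data.Nat using (ℕ; zero; suc; _+_; _*_; _∸_; _≤_; _≟_)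
open import Data.Bool using (Bool; true; false; if_then_else_; _∧_; _∨_)
open import Data.Fin using (Fin)
import Data.Fin as F
open import Data.Product using (Σ; _×_; ∃)
open import Relation.Nullary.Decidable using (⌊_⌋)
open import Relation.Binary.PropositionalEquality using (_≡_)

record Graph (n : ℕ) : Set where
  field
    adj    : Fin n → Fin n → Bool
    sym    : ∀ u v → adj u v ≡ adj v u
    irrefl : ∀ v → adj v v ≡ false
open Graph public

countB : ∀ {n} → (Fin n → Bool) → ℕ
countB {zero}  f = 0
countB {suc n} f = (if f F.zero then 1 else 0) + countB (λ i → f (F.suc i))

anyB : ∀ {n} → (Fin n → Bool) → Bool
anyB {zero}  f = false
anyB {suc n} f = f F.zero ∨ anyB (λ i → f (F.suc i))

module _ {n : ℕ} (G : Graph n) where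

  deg : Fin n → ℕ
  deg v = countB (adj G v)

  isPendant : Fin n → Bool
  isPendant v = ⌊ deg v ≟ 1 ⌋

  isSupport : Fin n → Bool
  isSupport v = anyB (λ u → adj G v u ∧ isPendant u)

  numPendant : ℕ
  numPendant = countB isPendant

  numSupport : ℕ
  numSupport = countB isSupport

  data Reach : Fin n → Fin n → Set where
    here : ∀ {v} → Reach v v
    step : ∀ {u w v} → adj G u w ≡ true → Reach w v → Reach u v

  Connected : Set
  Connected = ∀ u v → Reach u v

  inClosedNbhd : Fin n → Fin n → Bool
  inClosedNbhd v u = ⌊ u F.≟ v ⌋ ∨ adj G v u

  IsLimitedPacking : ℕ → (Fin n → Bool) → Set
  IsLimitedPacking k B = ∀ v → countB (λ u → inClosedNbhd v u ∧ B u) ≤ k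

  IsLimitedPackingNumber : ℕ → ℕ → Set
  IsLimitedPackingNumber k m =
    Σ (Fin n → Bool) (λ B → IsLimitedPacking k B × countB B ≡ m)
    × (∀ B → IsLimitedPacking k B → countB B ≤ m)

  IsMinNonPendantDegree : ℕ → Set
  IsMinNonPendantDegree d =
    Σ (Fin n) (λ v → isPendant v ≡ false × deg v ≡ d)
    × (∀ v → isPendant v ≡ false → d ≤ deg v)

-- Double count the incidences u ∈ N[v] with u ∈ B: give each u ∈ B one unit for every non-pendant v
-- with u ∈ N[v], and δ* units for every such support vertex v. Each u ∈ B collects at least 1 + δ*:
-- a pendant u lies in N[v] for its neighbour v, which is a support vertex and, as G is connected
-- with n ≥ 3, not pendant; a support vertex u lies in its own N[u]; any other u lies in N[u] and in
-- the N[v] of its ≥ δ* neighbours, none of which is pendant. Since |N[v] ∩ B| ≤ 2, the total is at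
-- most 2(n − ℓ) + 2sδ*. The path P₃ (n = 3, ℓ = 2, s = 1, δ* = 2, L₂ = 2) attains the bound.

module Submission where

open import Defs hiding (sym)
open import Data.Nat using (ℕ; zero; suc; _+_; _*_; _∸_; _≤_; _<_; z≤n; s≤s; _≟_)
open import Data.Nat.Properties
  using (≤-refl; ≤-trans; ≤-reflexive; ≮⇒≥; <⇒≱; m≤m+n; m≤n+m; +-suc; m+n∸m≡n;
         +-mono-≤; +-mono-≤-<; *-monoʳ-≤; *-monoˡ-≤; *-comm; *-assoc; *-identityˡ;
         *-distribˡ-+; *-cancelʳ-≤; +-*-semiring; module ≤-Reasoning)
open import Algebra.Properties.Semiring.Sum +-*-semiring
  using (sum; sum-syntax; sum-cong-≗; ∑-comm; ∑-distrib-+; *-distribˡ-sum; *-distribʳ-sum)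
open import Data.Bool using (Bool; true; false; not; _∧_; _xor_; if_then_else_)
open import Data.Bool.Properties using (∧-comm; ∧-assoc; ∨-zeroʳ; xor-comm; xor-same)
open import Data.Fin using (Fin; zero; suc)
import Data.Fin as F
open import Data.Fin.Patterns using (0F; 1F; 2F)
open import Data.Fin.Properties using (pigeonhole) renaming (<-irrefl to <-irreflᶠ)
open import Data.Product using (Σ; ∃; _×_; _,_)
open import Data.Sum using (_⊎_; inj₁; inj₂)
open import Function using (_∘_)
open import Relation.Nullary using (yes; no; contradiction)
open import Relation.Binary.PropositionalEquality
  using (_≡_; refl; sym; trans; cong; cong₂; subst; module ≡-Reasoning)

[_] : Bool → ℕ
[ b ] = if b then 1 else 0

[]*[]≡[∧] : ∀ a b → [ a ] * [ b ] ≡ [ a ∧ b ]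
[]*[]≡[∧] true  true  = refl
[]*[]≡[∧] true  false = refl
[]*[]≡[∧] false _     = refl

∑-mono-≤ : ∀ {n} {f g : Fin n → ℕ} → (∀ i → f i ≤ g i) → sum f ≤ sum g
∑-mono-≤ {zero}  f≤g = z≤n
∑-mono-≤ {suc n} f≤g = +-mono-≤ (f≤g zero) (∑-mono-≤ (f≤g ∘ suc))

countB≡∑ : ∀ {n} (f : Fin n → Bool) → countB f ≡ ∑[ i < n ] [ f i ]
countB≡∑ {zero}  f = refl
countB≡∑ {suc n} f = cong ([ f zero ] +_) (countB≡∑ (f ∘ suc))

[]*countB≡∑∧ : ∀ {n} a (f : Fin n → Bool) → [ a ] * countB f ≡ ∑[ i < n ] [ a ∧ f i ]
[]*countB≡∑∧ {n} a f = begin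
  [ a ] * countB f                ≡⟨ cong ([ a ] *_) (countB≡∑ f) ⟩
  [ a ] * ∑[ i < n ] [ f i ]      ≡⟨ *-distribˡ-sum [ a ] (λ i → [ f i ]) ⟩
  ∑[ i < n ] ([ a ] * [ f i ])    ≡⟨ sum-cong-≗ (λ i → []*[]≡[∧] a (f i)) ⟩
  ∑[ i < n ] [ a ∧ f i ]          ∎
  where open ≡-Reasoning

countB-pos : ∀ {n} (f : Fin n → Bool) {i} → f i ≡ true → 1 ≤ countB f
countB-pos f {zero}  fi rewrite fi = s≤s z≤n
countB-pos f {suc i} fi = ≤-trans (countB-pos (f ∘ suc) fi) (m≤n+m _ _)

countB-witness : ∀ {n} (f : Fin n → Bool) → 1 ≤ countB f → ∃ λ i → f i ≡ true
countB-witness {suc n} f 1≤c with f zero in e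
... | true  = zero , e
... | false = let i , fi = countB-witness (f ∘ suc) 1≤c in suc i , fi

countB≤1⇒unique : ∀ {n} (f : Fin n → Bool) → countB f ≤ 1 →
                  ∀ {i j} → f i ≡ true → f j ≡ true → i ≡ j
countB≤1⇒unique f c {zero}  {zero}  fi fj = refl
countB≤1⇒unique f c {zero}  {suc j} fi fj =
  contradiction (≤-trans (countB-pos (f ∘ suc) fj) (tail≤0 fi c)) λ ()
  where
  tail≤0 : ∀ {b m} → b ≡ true → [ b ] + m ≤ 1 → m ≤ 0
  tail≤0 refl (s≤s m≤0) = m≤0
countB≤1⇒unique f c {suc i} {zero}  fi fj = sym (countB≤1⇒unique f c fj fi)
countB≤1⇒unique f c {suc i} {suc j} fi fj =
  cong suc (countB≤1⇒unique (f ∘ suc) (≤-trans (m≤n+m _ _) c) fi fj)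

anyB-intro : ∀ {n} (f : Fin n → Bool) {i} → f i ≡ true → anyB f ≡ true
anyB-intro f {zero}  fi rewrite fi = refl
anyB-intro f {suc i} fi rewrite anyB-intro (f ∘ suc) fi = ∨-zeroʳ _

[]-mono : ∀ {a b} → (a ≡ true → b ≡ true) → [ a ] ≤ [ b ]
[]-mono {false} _   = z≤n
[]-mono {true}  a⇒b rewrite a⇒b refl = ≤-refl

countB-mono : ∀ {n} {f g : Fin n → Bool} → (∀ i → f i ≡ true → g i ≡ true) →
              countB f ≤ countB g
countB-mono {zero}  f⊆g = z≤n
countB-mono {suc n} f⊆g = +-mono-≤ ([]-mono (f⊆g zero)) (countB-mono (f⊆g ∘ suc))

countB-mono-< : ∀ {n} {f g : Fin n → Bool} → (∀ i → f i ≡ true → g i ≡ true) →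
                ∀ {j} → f j ≡ false → g j ≡ true → countB f < countB g
countB-mono-< f⊆g {zero}  fj gj rewrite fj | gj = s≤s (countB-mono (f⊆g ∘ suc))
countB-mono-< f⊆g {suc j} fj gj = +-mono-≤-< ([]-mono (f⊆g zero)) (countB-mono-< (f⊆g ∘ suc) fj gj)

countB+countB-not : ∀ {n} (f : Fin n → Bool) → countB f + countB (not ∘ f) ≡ n
countB+countB-not {zero}  f = refl
countB+countB-not {suc n} f with f zero
... | true  = cong suc (countB+countB-not (f ∘ suc))
... | false = trans (+-suc _ _) (cong suc (countB+countB-not (f ∘ suc)))

n∸countB≡countB-not : ∀ {n} (f : Fin n → Bool) → n ∸ countB f ≡ countB (not ∘ f)
n∸countB≡countB-not {n} f = begin
  n ∸ countB f                              ≡⟨ cong (_∸ countB f) (sym (countB+countB-not f)) ⟩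
  (countB f + countB (not ∘ f)) ∸ countB f  ≡⟨ m+n∸m≡n (countB f) _ ⟩
  countB (not ∘ f)                          ∎
  where open ≡-Reasoning

double-count : ∀ {m n} (P : Fin m → Bool) (Q : Fin n → Bool) (R : Fin n → Fin m → Bool) →
               ∑[ u < m ] ([ P u ] * countB (λ v → Q v ∧ R v u)) ≡
               ∑[ v < n ] ([ Q v ] * countB (λ u → R v u ∧ P u))
double-count {m} {n} P Q R = begin
  ∑[ u < m ] ([ P u ] * countB (λ v → Q v ∧ R v u))
    ≡⟨ sum-cong-≗ (λ u → []*countB≡∑∧ (P u) (λ v → Q v ∧ R v u)) ⟩
  ∑[ u < m ] ∑[ v < n ] [ P u ∧ (Q v ∧ R v u) ]
    ≡⟨ ∑-comm (λ u v → [ P u ∧ (Q v ∧ R v u) ]) ⟩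
  ∑[ v < n ] ∑[ u < m ] [ P u ∧ (Q v ∧ R v u) ]
    ≡⟨ sum-cong-≗ (λ v → sum-cong-≗ (λ u → cong [_] (rotate (P u) (Q v) (R v u)))) ⟩
  ∑[ v < n ] ∑[ u < m ] [ Q v ∧ (R v u ∧ P u) ]
    ≡⟨ sum-cong-≗ (λ v → []*countB≡∑∧ (Q v) (λ u → R v u ∧ P u)) ⟨
  ∑[ v < n ] ([ Q v ] * countB (λ u → R v u ∧ P u))
    ∎
  where
  open ≡-Reasoning
  rotate : ∀ p q r → p ∧ (q ∧ r) ≡ q ∧ (r ∧ p)
  rotate p q r = trans (∧-comm p (q ∧ r)) (∧-assoc q r p)

1+d≤x+y*d : ∀ {d x y} → 1 ≤ x → 1 ≤ y → 1 + d ≤ x + y * d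
1+d≤x+y*d {d} {y = y} 1≤x 1≤y = +-mono-≤ 1≤x (subst (_≤ y * d) (*-identityˡ d) (*-monoˡ-≤ d 1≤y))

covered-by-two⇒≤2 : ∀ {n} {a b : Fin n} → (∀ x → x ≡ a ⊎ x ≡ b) → n ≤ 2
covered-by-two⇒≤2 {a = a} {b} cover = ≮⇒≥ λ 2<n →
  let i , j , i<j , same-side = pigeonhole 2<n (side ∘ cover)
  in <-irreflᶠ (side-injective (cover i) (cover j) same-side) i<j
  where
  side : ∀ {x} → x ≡ a ⊎ x ≡ b → Fin 2
  side (inj₁ _) = 0F
  side (inj₂ _) = 1F
  side-injective : ∀ {x y} (p : x ≡ a ⊎ x ≡ b) (q : y ≡ a ⊎ y ≡ b) → side p ≡ side q → x ≡ y
  side-injective (inj₁ refl) (inj₁ refl) _ = refl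
  side-injective (inj₂ refl) (inj₂ refl) _ = refl
  side-injective (inj₁ _)    (inj₂ _)    ()
  side-injective (inj₂ _)    (inj₁ _)    ()

module _ {n} (G : Graph n) where

  inClosedNbhd-refl : ∀ v → inClosedNbhd G v v ≡ true
  inClosedNbhd-refl v with v F.≟ v
  ... | yes _   = refl
  ... | no v≢v = contradiction refl v≢v

  adj⇒inClosedNbhd : ∀ {u v} → adj G u v ≡ true → inClosedNbhd G v u ≡ true
  adj⇒inClosedNbhd {u} {v} uv rewrite Graph.sym G v u | uv = ∨-zeroʳ _

  pendant⇒deg≡1 : ∀ {u} → isPendant G u ≡ true → deg G u ≡ 1
  pendant⇒deg≡1 {u} pu with deg G u ≟ 1
  ... | yes deg≡1 = deg≡1

  pendant-nbr-unique : ∀ {u v w} → isPendant G u ≡ true →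
                       adj G u v ≡ true → adj G u w ≡ true → v ≡ w
  pendant-nbr-unique pu = countB≤1⇒unique _ (≤-reflexive (pendant⇒deg≡1 pu))

  pendant-nbr : ∀ {u} → isPendant G u ≡ true → ∃ λ v → adj G u v ≡ true
  pendant-nbr pu = countB-witness _ (≤-reflexive (sym (pendant⇒deg≡1 pu)))

  nbr-of-pendant-isSupport : ∀ {u v} → adj G u v ≡ true → isPendant G v ≡ true → isSupport G u ≡ true
  nbr-of-pendant-isSupport {u} {v} uv pv =
    anyB-intro (λ w → adj G u w ∧ isPendant G w) {v} (cong₂ _∧_ uv pv)

  nonSupport-nbr-nonPendant : ∀ {u v} → isSupport G u ≡ false →
                              adj G u v ≡ true → isPendant G v ≡ false
  nonSupport-nbr-nonPendant {v = v} su uv with isPendant G v in pv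
  ... | false = refl
  ... | true  = contradiction (trans (sym (nbr-of-pendant-isSupport uv pv)) su) λ ()

  walk-from-pendant-edge : ∀ {u v} → isPendant G u ≡ true → isPendant G v ≡ true → adj G u v ≡ true →
                           ∀ {x y} → Reach G x y → x ≡ u ⊎ x ≡ v → y ≡ u ⊎ y ≡ v
  walk-from-pendant-edge pu pv uv here x∈uv = x∈uv
  walk-from-pendant-edge pu pv uv (step xw w⇝y) (inj₁ refl) =
    walk-from-pendant-edge pu pv uv w⇝y (inj₂ (pendant-nbr-unique pu xw uv))
  walk-from-pendant-edge {u} {v} pu pv uv (step xw w⇝y) (inj₂ refl) =
    walk-from-pendant-edge pu pv uv w⇝y (inj₁ (pendant-nbr-unique pv xw (trans (Graph.sym G v u) uv)))

  pendant-nbr-nonPendant : 2 < n → Connected G →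
                           ∀ {u v} → isPendant G u ≡ true → adj G u v ≡ true → isPendant G v ≡ false
  pendant-nbr-nonPendant 2<n connected {u} {v} pu uv with isPendant G v in pv
  ... | false = refl
  ... | true  = contradiction
    (covered-by-two⇒≤2 (λ y → walk-from-pendant-edge pu pv uv (connected u y) (inj₁ refl)))
    (<⇒≱ 2<n)

  coverage : (Fin n → Bool) → Fin n → ℕ
  coverage Q u = countB (λ v → Q v ∧ inClosedNbhd G v u)

  coverage-pos : ∀ {Q u v} → Q v ≡ true → inClosedNbhd G v u ≡ true → 1 ≤ coverage Q u
  coverage-pos {Q} {u} {v} qv u∈N[v] =
    countB-pos (λ w → Q w ∧ inClosedNbhd G w u) {v} (cong₂ _∧_ qv u∈N[v])

  coverage-lower-bound : 2 < n → Connected G →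
    ∀ {d} → (∀ v → isPendant G v ≡ false → d ≤ deg G v) →
    ∀ u → 1 + d ≤ coverage (not ∘ isPendant G) u + coverage (isSupport G) u * d
  coverage-lower-bound 2<n connected {d} δ*≤deg u with isPendant G u in pu
  ... | true =
    let v , uv = pendant-nbr pu
        u∈N[v] = adj⇒inClosedNbhd uv
    in 1+d≤x+y*d (coverage-pos (cong not (pendant-nbr-nonPendant 2<n connected pu uv)) u∈N[v])
                (coverage-pos (nbr-of-pendant-isSupport (trans (Graph.sym G _ u) uv) pu) u∈N[v])
  ... | false with isSupport G u in su
  ...   | true  = 1+d≤x+y*d (coverage-pos (cong not pu) (inClosedNbhd-refl u))
                            (coverage-pos su (inClosedNbhd-refl u))
  ...   | false = begin
    1 + d                                ≤⟨ s≤s (δ*≤deg u pu) ⟩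
    1 + deg G u                          ≤⟨ deg<coverage ⟩
    coverage (not ∘ isPendant G) u       ≤⟨ m≤m+n _ _ ⟩
    coverage (not ∘ isPendant G) u + _   ∎
    where
    open ≤-Reasoning
    deg<coverage : deg G u < coverage (not ∘ isPendant G) u
    deg<coverage = countB-mono-< {f = adj G u} {g = λ v → not (isPendant G v) ∧ inClosedNbhd G v u}
      (λ v uv → cong₂ _∧_ (cong not (nonSupport-nbr-nonPendant su uv)) (adj⇒inClosedNbhd uv))
      {u} (Graph.irrefl G u) (cong₂ _∧_ (cong not pu) (inClosedNbhd-refl u))

  packing-coverage-≤ : ∀ {k B} → IsLimitedPacking G k B → (Q : Fin n → Bool) →
                       ∑[ u < n ] ([ B u ] * coverage Q u) ≤ k * countB Q
  packing-coverage-≤ {k} {B} packing Q = begin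
    ∑[ u < n ] ([ B u ] * coverage Q u)
      ≡⟨ double-count B Q (inClosedNbhd G) ⟩
    ∑[ v < n ] ([ Q v ] * countB (λ u → inClosedNbhd G v u ∧ B u))
      ≤⟨ ∑-mono-≤ (λ v → *-monoʳ-≤ [ Q v ] (packing v)) ⟩
    ∑[ v < n ] ([ Q v ] * k)
      ≡⟨ *-distribʳ-sum k (λ v → [ Q v ]) ⟨
    (∑[ v < n ] [ Q v ]) * k
      ≡⟨ cong (_* k) (countB≡∑ Q) ⟨
    countB Q * k
      ≡⟨ *-comm (countB Q) k ⟩
    k * countB Q
      ∎
    where open ≤-Reasoning

  2-packing-bound : 2 < n → Connected G → ∀ {d} → IsMinNonPendantDegree G d →
                    ∀ {B} → IsLimitedPacking G 2 B →
                    countB B * (1 + d) ≤ 2 * ((n ∸ numPendant G) + numSupport G * d)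
  2-packing-bound 2<n connected {d} (_ , δ*≤deg) {B} packing = begin
    countB B * (1 + d)
      ≡⟨ countB*≡∑[]* (1 + d) ⟩
    ∑[ u < n ] ([ B u ] * (1 + d))
      ≤⟨ ∑-mono-≤ (λ u → *-monoʳ-≤ [ B u ] (coverage-lower-bound 2<n connected δ*≤deg u)) ⟩
    ∑[ u < n ] ([ B u ] * (cNP u + cS u * d))
      ≡⟨ split ⟩
    ∑NP + ∑S * d
      ≤⟨ +-mono-≤ (packing-coverage-≤ packing NP) (*-monoˡ-≤ d (packing-coverage-≤ packing S)) ⟩
    2 * countB NP + 2 * numSupport G * d
      ≡⟨ cong₂ _+_ (cong (2 *_) (sym (n∸countB≡countB-not P))) (*-assoc 2 (numSupport G) d) ⟩
    2 * (n ∸ numPendant G) + 2 * (numSupport G * d)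
      ≡⟨ *-distribˡ-+ 2 (n ∸ numPendant G) (numSupport G * d) ⟨
    2 * ((n ∸ numPendant G) + numSupport G * d)
      ∎
    where
    open ≤-Reasoning
    P S NP : Fin n → Bool
    P = isPendant G
    S = isSupport G
    NP = not ∘ P
    cNP cS : Fin n → ℕ
    cNP = coverage NP
    cS = coverage S
    ∑NP ∑S : ℕ
    ∑NP = ∑[ u < n ] ([ B u ] * cNP u)
    ∑S = ∑[ u < n ] ([ B u ] * cS u)

    countB*≡∑[]* : ∀ c → countB B * c ≡ ∑[ u < n ] ([ B u ] * c)
    countB*≡∑[]* c = trans (cong (_* c) (countB≡∑ B)) (*-distribʳ-sum c (λ u → [ B u ]))

    split : ∑[ u < n ] ([ B u ] * (cNP u + cS u * d)) ≡ ∑NP + ∑S * d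
    split = begin-equality
      ∑[ u < n ] ([ B u ] * (cNP u + cS u * d))
        ≡⟨ sum-cong-≗ (λ u → distrib [ B u ] (cNP u) (cS u)) ⟩
      ∑[ u < n ] ([ B u ] * cNP u + [ B u ] * cS u * d)
        ≡⟨ ∑-distrib-+ (λ u → [ B u ] * cNP u) (λ u → [ B u ] * cS u * d) ⟩
      ∑NP + ∑[ u < n ] ([ B u ] * cS u * d)
        ≡⟨ cong (∑NP +_) (*-distribʳ-sum d (λ u → [ B u ] * cS u)) ⟨
      ∑NP + ∑S * d
        ∎
      where
      distrib : ∀ b x y → b * (x + y * d) ≡ b * x + b * y * d
      distrib b x y = trans (*-distribˡ-+ b x (y * d)) (cong (b * x +_) (sym (*-assoc b y d)))

isCentre : Fin 3 → Bool
isCentre 0F = true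
isCentre _  = false

P₃ : Graph 3
P₃ = record
  { adj    = λ u v → isCentre u xor isCentre v
  ; sym    = λ u v → xor-comm (isCentre u) (isCentre v)
  ; irrefl = λ v → xor-same (isCentre v)
  }

P₃-connected : Connected P₃
P₃-connected u v = via-centre u (from-centre v)
  where
  from-centre : ∀ v → Reach P₃ 0F v
  from-centre 0F = here
  from-centre 1F = step refl here
  from-centre 2F = step refl here
  via-centre : ∀ u {v} → Reach P₃ 0F v → Reach P₃ u v
  via-centre 0F r = r
  via-centre 1F r = step refl r
  via-centre 2F r = step refl r

P₃-δ* : IsMinNonPendantDegree P₃ 2
P₃-δ* = (0F , refl , refl) , λ { 0F _ → ≤-refl ; 1F () ; 2F () }

P₃-L₂ : IsLimitedPackingNumber P₃ 2 2
P₃-L₂ = (leaves , leaves-packing , refl) , λ B packing →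
  *-cancelʳ-≤ (countB B) 2 3
    (2-packing-bound P₃ (s≤s (s≤s (s≤s z≤n))) P₃-connected P₃-δ* {B} packing)
  where
  leaves : Fin 3 → Bool
  leaves = not ∘ isCentre
  leaves-packing : IsLimitedPacking P₃ 2 leaves
  leaves-packing 0F = ≤-refl
  leaves-packing 1F = s≤s z≤n
  leaves-packing 2F = s≤s z≤n

theorem1 : ((n : ℕ) (G : Graph n) → 3 ≤ n → Connected G →
    (d L : ℕ) → IsMinNonPendantDegree G d → IsLimitedPackingNumber G 2 L →
    L * (1 + d) ≤ 2 * ((n ∸ numPendant G) + numSupport G * d))
    ×
    Σ ℕ (λ n → Σ (Graph n) (λ G → 3 ≤ n × Connected G ×
    Σ ℕ (λ d → Σ ℕ (λ L → IsMinNonPendantDegree G d × IsLimitedPackingNumber G 2 L ×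
    L * (1 + d) ≡ 2 * ((n ∸ numPendant G) + numSupport G * d)))))
theorem1 =
  upper-bound , (3 , P₃ , s≤s (s≤s (s≤s z≤n)) , P₃-connected , 2 , 2 , P₃-δ* , P₃-L₂ , refl)
  where
  upper-bound : (n : ℕ) (G : Graph n) → 3 ≤ n → Connected G →
    (d L : ℕ) → IsMinNonPendantDegree G d → IsLimitedPackingNumber G 2 L →
    L * (1 + d) ≤ 2 * ((n ∸ numPendant G) + numSupport G * d)
  upper-bound n G 3≤n connected d L δ* ((B , packing , |B|≡L) , _) =
    subst (λ m → m * (1 + d) ≤ _) |B|≡L (2-packing-bound G 3≤n connected δ* packing)
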